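{- Let $T$ be a finite rooted ordered tree and let $v_1,v_2$ be non-root nodes of $T$ such that $v_2$ is the rightmost child of $v_1$. Then in $\mathrm{DFUDS}(T)$, $D[\mathrm{CP}(v_2)]=D[\mathrm{CP}(v_1)]$.
   Context: $\mathrm{DFUDS}(T)$ is the parenthesis sequence consisting of a single '(' followed by the concatenation, over all nodes of $T$ in depth-first (pre)order, of $d$ copies of '(' and then one ')', where $d$ is the number of children of the node. Positions are indexed from $1$. For a non-root node $v$ that is the $i$-th non-root node in depth-first order, $\mathrm{CP}(v)$ is the position of the $i$-th ')' in $\mathrm{DFUDS}(T)$ (the parenthesis immediately preceding the block written for $v$). For a position $x$, $D[x]$ is the number of '(' minus the number of ')' among positions $1,\ldots,x$. -}

module Defs where

open import Data.Nat using (ℕ; zero; suc)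
open import Data.Bool using (Bool; true; false)
open import Data.Integer using (ℤ; +_; _-_)
open import Data.List using (List; []; _∷_; _++_; map; length; replicate)
open import Data.Maybe using (Maybe; just; nothing)
open import Relation.Binary.PropositionalEquality using (_≡_)
open import Relation.Nullary using (yes; no)
open import Data.List.Properties using (≡-dec)
open import Data.Nat.Properties using (_≟_)

data Tree : Set where
  node : List Tree → Tree

children : Tree → List Tree
children (node cs) = cs

degree : Tree → ℕ
degree t = length (children t)

-- A node is addressed by its path from the root: the list of (0-based)
-- child indices. The root is [].
Addr : Set
Addr = List ℕ

subtree : Tree → Addr → Maybe Tree
lookupChild : List Tree → ℕ → Addr → Maybe Tree
subtree t [] = just t
subtree (node cs) (i ∷ a) = lookupChild cs i a
lookupChild [] i a = nothing
lookupChild (c ∷ cs) zero a = subtree c a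
lookupChild (c ∷ cs) (suc i) a = lookupChild cs i a

preorder : Tree → List Addr
preorderF : ℕ → List Tree → List Addr
preorder (node cs) = [] ∷ preorderF 0 cs
preorderF i [] = []
preorderF i (c ∷ cs) = map (i ∷_) (preorder c) ++ preorderF (suc i) cs

-- Parenthesis sequences: true = '(' , false = ')'.
Parens : Set
Parens = List Bool

blocks : Tree → Parens
blocksF : List Tree → Parens
blocks (node cs) = replicate (length cs) true ++ (false ∷ []) ++ blocksF cs
blocksF [] = []
blocksF (c ∷ cs) = blocks c ++ blocksF cs

DFUDS : Tree → Parens
DFUDS t = true ∷ blocks t

indexOf : Addr → List Addr → Maybe ℕ
indexOf a [] = nothing
indexOf a (b ∷ bs) with ≡-dec _≟_ a b
... | yes _ = just zero
... | no _ with indexOf a bs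
...   | just k = just (suc k)
...   | nothing = nothing

-- 1-based position of the k-th ')' (k ≥ 1) in a parenthesis sequence.
nthClose : ℕ → Parens → Maybe ℕ
nthClose k [] = nothing
nthClose k (true ∷ p) with nthClose k p
... | just x = just (suc x)
... | nothing = nothing
nthClose zero (false ∷ p) = nothing
nthClose (suc zero) (false ∷ p) = just 1
nthClose (suc (suc k)) (false ∷ p) with nthClose (suc k) p
... | just x = just (suc x)
... | nothing = nothing

-- CP(v): if v is the i-th non-root node in preorder (i.e. has 0-based
-- preorder index i, the root having index 0), the position of the i-th ')'.
CP : Tree → Addr → Maybe ℕ
CP t v with indexOf v (preorder t)
... | just i = nthClose i (DFUDS t)
... | nothing = nothing

excess : ℕ → Parens → ℤ
excess zero p = + 0
excess (suc x) [] = + 0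
excess (suc x) (true ∷ p) = + 1 Data.Integer.+ excess x p
excess (suc x) (false ∷ p) = excess x p - + 1

D : Tree → ℕ → ℤ
D t x = excess x (DFUDS t)

{-# OPTIONS --safe #-}

-- Let P be the concatenation of the DFUDS blocks of the nodes preceding v in
-- preorder, so that DFUDS(T) = '(' P (block of v) ... . P contains one ')' per
-- node, i.e. as many as v's preorder index, and for v ≠ root it ends with
-- ')'; hence CP(v) = 1 + |P| and D[CP(v)] = 1 + balance P. If v₂ is the
-- rightmost child of v₁, P₂ extends P₁ by v₁'s block (d '(' and one ')') and
-- the blocks of v₁'s first d − 1 children, each of balance −1, so the
-- extension has balance d − 1 − (d − 1) = 0.

module Submission where

open import Defs
open import Data.Bool using (true; false)
open import Data.Empty using (⊥-elim)
open import Data.Integer using (ℤ; +_; -_; 1ℤ; -1ℤ; _+_)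
import Data.Integer.Properties as ℤ
open import Data.Integer.Tactic.RingSolver using (solve-∀)
open import Data.List using (List; []; _∷_; _++_; _∷ʳ_; map; length; replicate)
open import Data.List.Properties
  using ( ++-assoc; ++-identityʳ; ++-conicalʳ; ∷ʳ-++; ∷-injectiveˡ; ∷-injectiveʳ
        ; length-++; length-map; ≡-dec)
open import Data.Maybe using (Maybe; just; nothing; _<∣>_)
import Data.Maybe as Maybe
open import Data.Maybe.Properties using (map-id; map-∘; map-<∣>)
open import Data.Nat as ℕ using (ℕ; zero; suc; _≤_; _<_; z≤n; s≤s)
import Data.Nat.Properties as ℕ
open import Data.Product using (∃; ∃₂; _×_; _,_)
open import Function using (_∘_)
open import Relation.Binary.PropositionalEquality
  using (_≡_; _≢_; refl; sym; trans; cong; cong₂; subst; module ≡-Reasoning)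
open import Relation.Nullary using (Dec; yes; no)

open ≡-Reasoning

closes : Parens → ℕ
closes []          = 0
closes (true ∷ p)  = closes p
closes (false ∷ p) = suc (closes p)

balance : Parens → ℤ
balance []          = + 0
balance (true ∷ p)  = 1ℤ + balance p
balance (false ∷ p) = -1ℤ + balance p

closes-++ : ∀ P Q → closes (P ++ Q) ≡ closes P ℕ.+ closes Q
closes-++ []          Q = refl
closes-++ (true ∷ P)  Q = closes-++ P Q
closes-++ (false ∷ P) Q = cong suc (closes-++ P Q)

closes-∷ʳ-close : ∀ P → closes (P ∷ʳ false) ≡ suc (closes P)
closes-∷ʳ-close P = trans (closes-++ P (false ∷ [])) (ℕ.+-comm (closes P) 1)

closes-opens : ∀ n P → closes (replicate n true ++ P) ≡ closes P
closes-opens zero    P = refl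
closes-opens (suc n) P = closes-opens n P

balance-++ : ∀ P Q → balance (P ++ Q) ≡ balance P + balance Q
balance-++ []          Q = sym (ℤ.+-identityˡ (balance Q))
balance-++ (true ∷ P)  Q =
  trans (cong (_+_ 1ℤ) (balance-++ P Q)) (sym (ℤ.+-assoc 1ℤ (balance P) (balance Q)))
balance-++ (false ∷ P) Q =
  trans (cong (_+_ -1ℤ) (balance-++ P Q)) (sym (ℤ.+-assoc -1ℤ (balance P) (balance Q)))

balance-opens : ∀ n P → balance (replicate n true ++ P) ≡ + n + balance P
balance-opens zero    P = sym (ℤ.+-identityˡ (balance P))
balance-opens (suc n) P =
  trans (cong (_+_ 1ℤ) (balance-opens n P)) (sym (ℤ.+-assoc 1ℤ (+ n) (balance P)))

-1+-n≡-[1+n] : ∀ n → -1ℤ + - + n ≡ - + suc n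
-1+-n≡-[1+n] n = sym (ℤ.neg-distrib-+ (+ 1) (+ n))

nthClose-∷ʳ : ∀ P X → nthClose (suc (closes P)) (P ++ false ∷ X) ≡ just (length (P ∷ʳ false))
nthClose-∷ʳ []          X = refl
nthClose-∷ʳ (true ∷ P)  X rewrite nthClose-∷ʳ P X = refl
nthClose-∷ʳ (false ∷ P) X rewrite nthClose-∷ʳ P X = refl

excess-++ : ∀ P X → excess (length P) (P ++ X) ≡ balance P
excess-++ []          X = refl
excess-++ (true ∷ P)  X = cong (_+_ 1ℤ) (excess-++ P X)
excess-++ (false ∷ P) X = trans (cong (_+ -1ℤ) (excess-++ P X)) (ℤ.+-comm (balance P) -1ℤ)

data EndsWithClose : Parens → Set where
  []      : EndsWithClose []
  closing : ∀ P → EndsWithClose (P ∷ʳ false)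

endsWithClose-++ : ∀ {P Q} → EndsWithClose P → EndsWithClose Q → EndsWithClose (P ++ Q)
endsWithClose-++ {P} p []          = subst EndsWithClose (sym (++-identityʳ P)) p
endsWithClose-++ {P} p (closing Q) =
  subst EndsWithClose (++-assoc P Q (false ∷ [])) (closing (P ++ Q))

endsWithClose-block : ∀ n {P} → EndsWithClose P → EndsWithClose (replicate n true ++ false ∷ P)
endsWithClose-block n {P} p =
  subst EndsWithClose (∷ʳ-++ (replicate n true) false P) (endsWithClose-++ (closing (replicate n true)) p)

nthClose-closes : ∀ {P} X → EndsWithClose P → P ≢ [] → nthClose (closes P) (P ++ X) ≡ just (length P)
nthClose-closes X []          P≢[] = ⊥-elim (P≢[] refl)
nthClose-closes X (closing P) _    = begin
  nthClose (closes (P ∷ʳ false)) (P ∷ʳ false ++ X)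
    ≡⟨ cong₂ nthClose (closes-∷ʳ-close P) (∷ʳ-++ P false X) ⟩
  nthClose (suc (closes P)) (P ++ false ∷ X)
    ≡⟨ nthClose-∷ʳ P X ⟩
  just (length (P ∷ʳ false))
    ∎

indexOf-here : ∀ a L → indexOf a (a ∷ L) ≡ just 0
indexOf-here a L with ≡-dec ℕ._≟_ a a
... | yes _   = refl
... | no a≢a = ⊥-elim (a≢a refl)

indexOf-there : ∀ {a b} L → a ≢ b → indexOf a (b ∷ L) ≡ Maybe.map suc (indexOf a L)
indexOf-there {a} {b} L a≢b with ≡-dec ℕ._≟_ a b
... | yes a≡b = ⊥-elim (a≢b a≡b)
... | no _ with indexOf a L
...   | just k  = refl
...   | nothing = refl

indexOf-++ : ∀ a L K → indexOf a (L ++ K) ≡ indexOf a L <∣> Maybe.map (length L ℕ.+_) (indexOf a K)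
indexOf-++ a []      K = sym (map-id (indexOf a K))
-- The case split goes through a helper rather than `with`, which would rewrite
-- the goal's `indexOf a (b ∷ …)` into an unfolded form that `indexOf-there` no
-- longer matches.
indexOf-++ a (b ∷ L) K = by-cases (≡-dec ℕ._≟_ a b)
  where
    inK : ℕ → Maybe ℕ
    inK offset = Maybe.map (offset ℕ.+_) (indexOf a K)

    by-cases : Dec (a ≡ b) → indexOf a (b ∷ L ++ K) ≡ indexOf a (b ∷ L) <∣> inK (suc (length L))
    by-cases (yes refl) =
      trans (indexOf-here a (L ++ K)) (cong (_<∣> inK (suc (length L))) (sym (indexOf-here a L)))
    by-cases (no a≢b)   = begin
      indexOf a (b ∷ L ++ K)                                        ≡⟨ indexOf-there (L ++ K) a≢b ⟩
      Maybe.map suc (indexOf a (L ++ K))                            ≡⟨ cong (Maybe.map suc) (indexOf-++ a L K) ⟩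
      Maybe.map suc (indexOf a L <∣> inK (length L))                ≡⟨ map-<∣> suc (indexOf a L) (inK (length L)) ⟩
      Maybe.map suc (indexOf a L) <∣> Maybe.map suc (inK (length L))
        ≡⟨ cong₂ _<∣>_ (sym (indexOf-there L a≢b)) (sym (map-∘ (indexOf a K))) ⟩
      indexOf a (b ∷ L) <∣> inK (suc (length L))                    ∎

indexOf-map-∷ : ∀ k a L → indexOf (k ∷ a) (map (k ∷_) L) ≡ indexOf a L
indexOf-map-∷ k a []      = refl
indexOf-map-∷ k a (b ∷ L) = by-cases (≡-dec ℕ._≟_ a b)
  where
    by-cases : Dec (a ≡ b) → indexOf (k ∷ a) (map (k ∷_) (b ∷ L)) ≡ indexOf a (b ∷ L)
    by-cases (yes refl) = trans (indexOf-here (k ∷ a) (map (k ∷_) L)) (sym (indexOf-here a L))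
    by-cases (no a≢b)   = begin
      indexOf (k ∷ a) ((k ∷ b) ∷ map (k ∷_) L)       ≡⟨ indexOf-there (map (k ∷_) L) (a≢b ∘ ∷-injectiveʳ) ⟩
      Maybe.map suc (indexOf (k ∷ a) (map (k ∷_) L)) ≡⟨ cong (Maybe.map suc) (indexOf-map-∷ k a L) ⟩
      Maybe.map suc (indexOf a L)                    ≡⟨ indexOf-there L a≢b ⟨
      indexOf a (b ∷ L)                              ∎

indexOf-map-∷-≢ : ∀ {k k′} a L → k ≢ k′ → indexOf (k ∷ a) (map (k′ ∷_) L) ≡ nothing
indexOf-map-∷-≢          a []      k≢k′ = refl
indexOf-map-∷-≢ {k} {k′} a (b ∷ L) k≢k′ = begin
  indexOf (k ∷ a) ((k′ ∷ b) ∷ map (k′ ∷_) L)      ≡⟨ indexOf-there (map (k′ ∷_) L) (k≢k′ ∘ ∷-injectiveˡ) ⟩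
  Maybe.map suc (indexOf (k ∷ a) (map (k′ ∷_) L)) ≡⟨ cong (Maybe.map suc) (indexOf-map-∷-≢ a L k≢k′) ⟩
  nothing                                         ∎

blocks-endsWithClose  : ∀ t → EndsWithClose (blocks t)
blocksF-endsWithClose : ∀ cs → EndsWithClose (blocksF cs)
blocks-endsWithClose (node cs) = endsWithClose-block (length cs) (blocksF-endsWithClose cs)
blocksF-endsWithClose []       = []
blocksF-endsWithClose (c ∷ cs) = endsWithClose-++ (blocks-endsWithClose c) (blocksF-endsWithClose cs)

length-preorder  : ∀ t → length (preorder t) ≡ closes (blocks t)
length-preorderF : ∀ i cs → length (preorderF i cs) ≡ closes (blocksF cs)
length-preorder (node cs) =
  trans (cong suc (length-preorderF 0 cs)) (sym (closes-opens (length cs) (false ∷ blocksF cs)))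
length-preorderF i []       = refl
length-preorderF i (c ∷ cs) = begin
  length (here ++ preorderF (suc i) cs)               ≡⟨ length-++ here ⟩
  length here ℕ.+ length (preorderF (suc i) cs)       ≡⟨ cong₂ ℕ._+_ length-here (length-preorderF (suc i) cs) ⟩
  closes (blocks c) ℕ.+ closes (blocksF cs)           ≡⟨ closes-++ (blocks c) (blocksF cs) ⟨
  closes (blocks c ++ blocksF cs)                     ∎
  where
    here : List Addr
    here = map (i ∷_) (preorder c)

    length-here : length here ≡ closes (blocks c)
    length-here = trans (length-map (i ∷_) (preorder c)) (length-preorder c)

balance-blocks  : ∀ t → balance (blocks t) ≡ -1ℤ
balance-blocksF : ∀ cs → balance (blocksF cs) ≡ - + length cs
balance-blocks (node cs) = begin
  balance (replicate d true ++ false ∷ blocksF cs) ≡⟨ balance-opens d (false ∷ blocksF cs) ⟩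
  + d + (-1ℤ + balance (blocksF cs))               ≡⟨ cong (λ b → + d + (-1ℤ + b)) (balance-blocksF cs) ⟩
  + d + (-1ℤ + - + d)                              ≡⟨ n+[-1+-n]≡-1 (+ d) ⟩
  -1ℤ                                              ∎
  where
    d : ℕ
    d = length cs

    n+[-1+-n]≡-1 : ∀ n → n + (-1ℤ + - n) ≡ -1ℤ
    n+[-1+-n]≡-1 = solve-∀
balance-blocksF []       = refl
balance-blocksF (c ∷ cs) = begin
  balance (blocks c ++ blocksF cs)          ≡⟨ balance-++ (blocks c) (blocksF cs) ⟩
  balance (blocks c) + balance (blocksF cs) ≡⟨ cong₂ _+_ (balance-blocks c) (balance-blocksF cs) ⟩
  -1ℤ + - + length cs                       ≡⟨ -1+-n≡-[1+n] (length cs) ⟩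
  - + suc (length cs)                       ∎

subtree-++     : ∀ t a b {s} → subtree t a ≡ just s → subtree t (a ++ b) ≡ subtree s b
lookupChild-++ : ∀ cs k a b {s} → lookupChild cs k a ≡ just s → lookupChild cs k (a ++ b) ≡ subtree s b
subtree-++ t         []      b refl = refl
subtree-++ (node cs) (k ∷ a) b sub  = lookupChild-++ cs k a b sub
lookupChild-++ (c ∷ cs) zero    a b sub = subtree-++ c a b sub
lookupChild-++ (c ∷ cs) (suc k) a b sub = lookupChild-++ cs k a b sub

lookupChild-< : ∀ cs {k} → k < length cs → ∃ λ s → lookupChild cs k [] ≡ just s
lookupChild-< (c ∷ cs) {zero}  _         = c , refl
lookupChild-< (c ∷ cs) {suc k} (s≤s k<n) = lookupChild-< cs k<n

blocksBefore  : Tree → Addr → Parens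
blocksBeforeF : List Tree → ℕ → Addr → Parens
blocksBefore t         []      = []
blocksBefore (node cs) (k ∷ a) = replicate (length cs) true ++ false ∷ blocksBeforeF cs k a
blocksBeforeF []       k       a = []
blocksBeforeF (c ∷ cs) zero    a = blocksBefore c a
blocksBeforeF (c ∷ cs) (suc k) a = blocks c ++ blocksBeforeF cs k a

blocksBefore-endsWithClose  : ∀ t a → EndsWithClose (blocksBefore t a)
blocksBeforeF-endsWithClose : ∀ cs k a → EndsWithClose (blocksBeforeF cs k a)
blocksBefore-endsWithClose t         []      = []
blocksBefore-endsWithClose (node cs) (k ∷ a) =
  endsWithClose-block (length cs) (blocksBeforeF-endsWithClose cs k a)
blocksBeforeF-endsWithClose []       k       a = []
blocksBeforeF-endsWithClose (c ∷ cs) zero    a = blocksBefore-endsWithClose c a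
blocksBeforeF-endsWithClose (c ∷ cs) (suc k) a =
  endsWithClose-++ (blocks-endsWithClose c) (blocksBeforeF-endsWithClose cs k a)

blocksBefore-≢[] : ∀ t {a} → a ≢ [] → blocksBefore t a ≢ []
blocksBefore-≢[] t         {[]}    a≢[] = ⊥-elim (a≢[] refl)
blocksBefore-≢[] (node cs) {k ∷ a} _    = (λ ()) ∘ ++-conicalʳ (replicate (length cs) true) _

blocks-split  : ∀ t a {s} → subtree t a ≡ just s →
                ∃ λ R → blocks t ≡ blocksBefore t a ++ blocks s ++ R
blocksF-split : ∀ cs k a {s} → lookupChild cs k a ≡ just s →
                ∃ λ R → blocksF cs ≡ blocksBeforeF cs k a ++ blocks s ++ R
blocks-split t         []      refl = [] , sym (++-identityʳ (blocks t))
blocks-split (node cs) (k ∷ a) {s} sub with blocksF-split cs k a sub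
... | R , split rewrite split =
  R , sym (++-assoc (replicate (length cs) true) (false ∷ blocksBeforeF cs k a) (blocks s ++ R))
blocksF-split (c ∷ cs) zero    a {s} sub with blocks-split c a sub
... | R , split rewrite split =
  R ++ blocksF cs ,
  trans (++-assoc (blocksBefore c a) (blocks s ++ R) (blocksF cs))
        (cong (blocksBefore c a ++_) (++-assoc (blocks s) R (blocksF cs)))
blocksF-split (c ∷ cs) (suc k) a {s} sub with blocksF-split cs k a sub
... | R , split rewrite split = R , sym (++-assoc (blocks c) (blocksBeforeF cs k a) (blocks s ++ R))

blocksBefore-++  : ∀ t a b {s} → subtree t a ≡ just s →
                   blocksBefore t (a ++ b) ≡ blocksBefore t a ++ blocksBefore s b
blocksBeforeF-++ : ∀ cs k a b {s} → lookupChild cs k a ≡ just s →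
                   blocksBeforeF cs k (a ++ b) ≡ blocksBeforeF cs k a ++ blocksBefore s b
blocksBefore-++ t         []      b refl = refl
blocksBefore-++ (node cs) (k ∷ a) b {s} sub rewrite blocksBeforeF-++ cs k a b sub =
  sym (++-assoc (replicate (length cs) true) (false ∷ blocksBeforeF cs k a) (blocksBefore s b))
blocksBeforeF-++ (c ∷ cs) zero    a b sub = blocksBefore-++ c a b sub
blocksBeforeF-++ (c ∷ cs) (suc k) a b {s} sub rewrite blocksBeforeF-++ cs k a b sub =
  sym (++-assoc (blocks c) (blocksBeforeF cs k a) (blocksBefore s b))

indexOf-preorder  : ∀ t a {s} → subtree t a ≡ just s →
                    indexOf a (preorder t) ≡ just (closes (blocksBefore t a))
indexOf-preorderF : ∀ i cs k a {s} → lookupChild cs k a ≡ just s →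
                    indexOf (i ℕ.+ k ∷ a) (preorderF i cs) ≡ just (closes (blocksBeforeF cs k a))
indexOf-preorder (node cs) []      refl = indexOf-here [] (preorderF 0 cs)
indexOf-preorder (node cs) (k ∷ a) sub  = begin
  indexOf (k ∷ a) ([] ∷ preorderF 0 cs)            ≡⟨ indexOf-there {b = []} (preorderF 0 cs) (λ ()) ⟩
  Maybe.map suc (indexOf (k ∷ a) (preorderF 0 cs)) ≡⟨ cong (Maybe.map suc) (indexOf-preorderF 0 cs k a sub) ⟩
  just (suc (closes (blocksBeforeF cs k a)))
    ≡⟨ cong just (closes-opens (length cs) (false ∷ blocksBeforeF cs k a)) ⟨
  just (closes (blocksBefore (node cs) (k ∷ a)))   ∎
indexOf-preorderF i (c ∷ cs) zero a sub rewrite ℕ.+-identityʳ i = begin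
  indexOf (i ∷ a) (here ++ later)    ≡⟨ indexOf-++ (i ∷ a) here later ⟩
  indexOf (i ∷ a) here <∣> inLater   ≡⟨ cong (_<∣> inLater) (indexOf-map-∷ i a (preorder c)) ⟩
  indexOf a (preorder c) <∣> inLater ≡⟨ cong (_<∣> inLater) (indexOf-preorder c a sub) ⟩
  just (closes (blocksBefore c a))   ∎
  where
    here later : List Addr
    here  = map (i ∷_) (preorder c)
    later = preorderF (suc i) cs

    inLater : Maybe ℕ
    inLater = Maybe.map (length here ℕ.+_) (indexOf (i ∷ a) later)
indexOf-preorderF i (c ∷ cs) (suc k) a sub rewrite ℕ.+-suc i k = begin
  indexOf key (here ++ later)
    ≡⟨ indexOf-++ key here later ⟩
  indexOf key here <∣> Maybe.map (length here ℕ.+_) (indexOf key later)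
    ≡⟨ cong₂ _<∣>_ (indexOf-map-∷-≢ a (preorder c) (suc-i+k≢i i))
                   (cong (Maybe.map (length here ℕ.+_)) (indexOf-preorderF (suc i) cs k a sub)) ⟩
  just (length here ℕ.+ closes (blocksBeforeF cs k a))
    ≡⟨ cong (λ n → just (n ℕ.+ closes (blocksBeforeF cs k a))) length-here ⟩
  just (closes (blocks c) ℕ.+ closes (blocksBeforeF cs k a))
    ≡⟨ cong just (closes-++ (blocks c) (blocksBeforeF cs k a)) ⟨
  just (closes (blocks c ++ blocksBeforeF cs k a))
    ∎
  where
    key : Addr
    key = suc (i ℕ.+ k) ∷ a

    here later : List Addr
    here  = map (i ∷_) (preorder c)
    later = preorderF (suc i) cs

    length-here : length here ≡ closes (blocks c)
    length-here = trans (length-map (i ∷_) (preorder c)) (length-preorder c)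

    suc-i+k≢i : ∀ i → suc (i ℕ.+ k) ≢ i
    suc-i+k≢i zero    ()
    suc-i+k≢i (suc i) eq = suc-i+k≢i i (ℕ.suc-injective eq)

CP-blocksBefore : ∀ T v {s} → v ≢ [] → subtree T v ≡ just s →
                  CP T v ≡ just (suc (length (blocksBefore T v)))
CP-blocksBefore T v {s} v≢[] sub with blocks-split T v sub
... | R , split
  rewrite indexOf-preorder T v sub
        | split
        | nthClose-closes (blocks s ++ R) (blocksBefore-endsWithClose T v) (blocksBefore-≢[] T v≢[])
  = refl

D-blocksBefore : ∀ T v {s} → subtree T v ≡ just s →
                 D T (suc (length (blocksBefore T v))) ≡ 1ℤ + balance (blocksBefore T v)
D-blocksBefore T v {s} sub with blocks-split T v sub
... | R , split rewrite split = cong (_+_ 1ℤ) (excess-++ (blocksBefore T v) (blocks s ++ R))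

balance-blocksBeforeF-[] : ∀ cs {k} → k ≤ length cs → balance (blocksBeforeF cs k []) ≡ - + k
balance-blocksBeforeF-[] []       z≤n             = refl
balance-blocksBeforeF-[] (c ∷ cs) z≤n             = refl
balance-blocksBeforeF-[] (c ∷ cs) {suc k} (s≤s k≤n) = begin
  balance (blocks c ++ blocksBeforeF cs k [])          ≡⟨ balance-++ (blocks c) (blocksBeforeF cs k []) ⟩
  balance (blocks c) + balance (blocksBeforeF cs k []) ≡⟨ cong₂ _+_ (balance-blocks c) (balance-blocksBeforeF-[] cs k≤n) ⟩
  -1ℤ + - + k                                          ≡⟨ -1+-n≡-[1+n] k ⟩
  - + suc k                                            ∎

balance-blocksBefore-lastChild : ∀ cs {j} → length cs ≡ suc j →
                                 balance (blocksBefore (node cs) (j ∷ [])) ≡ + 0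
balance-blocksBefore-lastChild cs {j} deg = begin
  balance (replicate (length cs) true ++ false ∷ blocksBeforeF cs j [])
    ≡⟨ balance-opens (length cs) (false ∷ blocksBeforeF cs j []) ⟩
  + length cs + (-1ℤ + balance (blocksBeforeF cs j []))
    ≡⟨ cong₂ (λ n b → + n + (-1ℤ + b)) deg (balance-blocksBeforeF-[] cs j≤deg) ⟩
  + suc j + (-1ℤ + - + j)
    ≡⟨ cong (_+_ (+ suc j)) (-1+-n≡-[1+n] j) ⟩
  + suc j + - + suc j
    ≡⟨ ℤ.+-inverseʳ (+ suc j) ⟩
  + 0
    ∎
  where
    j≤deg : j ≤ length cs
    j≤deg = subst (j ≤_) (sym deg) (ℕ.n≤1+n j)

balance-blocksBefore-∷ʳ-lastChild : ∀ T v {cs j} → subtree T v ≡ just (node cs) → length cs ≡ suc j →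
                                    balance (blocksBefore T (v ∷ʳ j)) ≡ balance (blocksBefore T v)
balance-blocksBefore-∷ʳ-lastChild T v {cs} {j} sub deg = begin
  balance (blocksBefore T (v ∷ʳ j)) ≡⟨ cong balance (blocksBefore-++ T v (j ∷ []) sub) ⟩
  balance (P ++ gap)                ≡⟨ balance-++ P gap ⟩
  balance P + balance gap           ≡⟨ cong (_+_ (balance P)) (balance-blocksBefore-lastChild cs deg) ⟩
  balance P + + 0                   ≡⟨ ℤ.+-identityʳ (balance P) ⟩
  balance P                         ∎
  where
    P gap : Parens
    P   = blocksBefore T v
    gap = blocksBefore (node cs) (j ∷ [])

lemma8 : (T : Tree) (v₁ : Addr) (cs : List Tree) (j : ℕ) →
           v₁ ≢ [] →
           subtree T v₁ ≡ just (node cs) →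
           length cs ≡ suc j →
           ∃₂ λ x₁ x₂ → CP T v₁ ≡ just x₁ × CP T (v₁ ∷ʳ j) ≡ just x₂ × D T x₂ ≡ D T x₁
lemma8 T v₁ cs j v₁≢[] sub₁ deg with lookupChild-< cs (ℕ.≤-reflexive (sym deg))
... | s₂ , child =
  _ , _ , CP-blocksBefore T v₁ v₁≢[] sub₁ , CP-blocksBefore T v₂ v₂≢[] sub₂ , (begin
    D T (suc (length (blocksBefore T v₂))) ≡⟨ D-blocksBefore T v₂ sub₂ ⟩
    1ℤ + balance (blocksBefore T v₂)       ≡⟨ cong (_+_ 1ℤ) (balance-blocksBefore-∷ʳ-lastChild T v₁ sub₁ deg) ⟩
    1ℤ + balance (blocksBefore T v₁)       ≡⟨ D-blocksBefore T v₁ sub₁ ⟨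
    D T (suc (length (blocksBefore T v₁))) ∎)
  where
    v₂ : Addr
    v₂ = v₁ ∷ʳ j

    v₂≢[] : v₂ ≢ []
    v₂≢[] = (λ ()) ∘ ++-conicalʳ v₁ (j ∷ [])

    sub₂ : subtree T v₂ ≡ just s₂
    sub₂ = trans (subtree-++ T v₁ (j ∷ []) sub₁) child
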